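{- Let $S$ be a signature and $t_1,t_2$ two $S$-terms of the same degree $n$ and the same decoration word. Then $t_1\preceq t_2$ if and only if, for every $i\in[n]$, the parent edge of $i$ in $t_1$ is dominated by the parent edge of $i$ in $t_2$.
   Context: A signature is a set $S$ with arity map $|\cdot|:S\to\mathbb N$. An $S$-term is the leaf $\ell$ or $s\,t_1\cdots t_{|s|}$ with $s\in S$ and $S$-terms $t_i$. Internal nodes are numbered $1,\dots,\deg t$ in preorder (root, then subterms left to right); $\mathrm{dc}(t)$ is the word of decorations. Children (leaves included) are numbered from $1$ left to right. The parent edge of internal node $i$ is $(\mathrm{pa}(i),\mathrm{lp}(i),i)$ where $i$ is the $\mathrm{lp}(i)$-th child of $\mathrm{pa}(i)$, with the convention that the parent edge of the root is $(1,0,1)$. $\mathrm{cnc}(t)(i)=\mathrm{pa}(i)+1-2^{\mathrm{lp}(i)-a}$ with $a$ the arity of the decoration of $\mathrm{pa}(i)$; $t_1\preceq t_2$ iff $\mathrm{dc}(t_1)=\mathrm{dc}(t_2)$ and $\mathrm{cnc}(t_1)(i)\le\mathrm{cnc}(t_2)(i)$ for all $i$. An edge $(i_1,j_1,i)$ is dominated by $(i_2,j_2,i)$ if $(i_1,-j_1)$ is lexicographically smaller than or equal to $(i_2,-j_2)$. -}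

module Defs where

open import Data.Nat using (ℕ; zero; suc; _+_; _∸_; _<_; _≤_)
open import Data.Fin using (Fin)
open import Data.Vec using (Vec; []; _∷_; _++_; lookup)
open import Data.List using (List; []; _∷_) renaming (_++_ to _++ˡ_)
open import Data.Product using (_×_; _,_)
open import Data.Sum using (_⊎_)
open import Data.Integer using (+_)
open import Relation.Binary.PropositionalEquality using (_≡_)
import Data.Rational as ℚ
open ℚ using (ℚ; ½; 1ℚ)

record Signature : Set₁ where
  field
    Sym   : Set
    arity : Sym → ℕ
open Signature public

module _ (Σ : Signature) where

  data Term : Set where
    leaf : Term
    node : (s : Sym Σ) → Vec Term (arity Σ s) → Term

  mutual
    deg : Term → ℕ
    deg leaf        = 0
    deg (node s ts) = suc (degs ts)

    degs : ∀ {m} → Vec Term m → ℕ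
    degs []       = 0
    degs (t ∷ ts) = deg t + degs ts

  mutual
    dc : Term → List (Sym Σ)
    dc leaf        = []
    dc (node s ts) = s ∷ dcs ts

    dcs : ∀ {m} → Vec Term m → List (Sym Σ)
    dcs []       = []
    dcs (t ∷ ts) = dc t ++ˡ dcs ts

  -- Parent-edge data of an internal node i:
  --   pa = pa(i), lp = lp(i), idx = i (preorder number, starting at 1),
  --   par = arity of the decoration of pa(i).
  record EdgeInfo : Set where
    constructor edge
    field
      pa  : ℕ
      lp  : ℕ
      idx : ℕ
      par : ℕ
  open EdgeInfo public

  -- pe t k p j a : edge data of the internal nodes of the subterm t, whose root
  -- has preorder number k and is the j-th child of node p whose decoration has arity a.
  mutual
    pe : (t : Term) → (k p j a : ℕ) → Vec EdgeInfo (deg t)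
    pe leaf        k p j a = []
    pe (node s ts) k p j a = edge p j k a ∷ pes ts (suc k) k 1 (arity Σ s)

    pes : ∀ {m} → (ts : Vec Term m) → (k p j a : ℕ) → Vec EdgeInfo (degs ts)
    pes []       k p j a = []
    pes (t ∷ ts) k p j a = pe t k p j a ++ pes ts (k + deg t) p (suc j) a

  -- parent edges of all internal nodes, in preorder; the root gets the
  -- conventional parent edge (1,0,1).
  parentEdges : (t : Term) → Vec EdgeInfo (deg t)
  parentEdges leaf        = []
  parentEdges (node s ts) = pe (node s ts) 1 1 0 (arity Σ s)

  -- parent edge of internal node number (toℕ i + 1)
  parentEdge : (t : Term) → Fin (deg t) → EdgeInfo
  parentEdge t i = lookup (parentEdges t) i

  halfPow : ℕ → ℚ
  halfPow zero    = 1ℚ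
  halfPow (suc k) = ½ ℚ.* halfPow k

  -- cnc(t)(i) = pa(i) + 1 - 2^(lp(i) - a); since lp(i) ≤ a, 2^(lp(i)-a) = 2^(-(a ∸ lp(i)))
  cnc : (t : Term) → Fin (deg t) → ℚ
  cnc t i = ((+ (pa e + 1)) ℚ./ 1) ℚ.- halfPow (par e ∸ lp e)
    where e = parentEdge t i

  _⪯_ : Term → Term → Set
  t₁ ⪯ t₂ = (dc t₁ ≡ dc t₂)
          × (∀ (i : ℕ) (p₁ : i < deg t₁) (p₂ : i < deg t₂) →
               cnc t₁ (Data.Fin.fromℕ< p₁) ℚ.≤ cnc t₂ (Data.Fin.fromℕ< p₂))

  Dominated : EdgeInfo → EdgeInfo → Set
  Dominated e₁ e₂ = (idx e₁ ≡ idx e₂)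
                  × ((pa e₁ < pa e₂) ⊎ ((pa e₁ ≡ pa e₂) × (lp e₂ ≤ lp e₁)))

module Submission where

-- cnc(t)(i) = pa(i) + 1 − 2^(lp(i) − a) lies in [pa(i), pa(i) + 1), so cnc values are ordered
-- first by parent; for equal parents the common decoration word fixes the arity a, and the
-- value decreases strictly in lp(i). Thus cnc(t₁)(i) ≤ cnc(t₂)(i) is exactly the lexicographic
-- comparison of (pa(i), −lp(i)), while the third components of both parent edges are the
-- preorder number i itself.

open import Defs
open import Data.Nat using (ℕ; _<_)
open import Data.Fin using (fromℕ<)
open import Relation.Binary.PropositionalEquality using (_≡_)
open import Function.Bundles using (_⇔_)

open import Data.Nat using (zero; suc; _+_; _∸_; _≤_; _≥_; z≤n; s≤s; s≤s⁻¹)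
import Data.Nat.Properties as ℕP
open import Data.Nat.Coprimality using (1-coprimeTo) renaming (sym to coprime-sym)
open import Data.Fin as Fin using (Fin; toℕ)
open import Data.Fin.Properties using (toℕ-fromℕ<)
open import Data.Integer as ℤ using (ℤ; +_)
import Data.Integer.Properties as ℤP
open import Data.Integer.Tactic.RingSolver using (solve-∀)
open import Data.Rational as ℚ using (ℚ; mkℚ; 0ℚ; 1ℚ; ½)
import Data.Rational.Properties as ℚP
open import Data.Rational.Unnormalised as ℚᵘ using (mkℚᵘ)
import Data.Rational.Unnormalised.Properties as ℚᵘP
open import Data.List using (List; []; _∷_; _++_; map; length; drop; head)
open import Data.List.Properties using (drop-drop; length-++; length-map; map-++; ++-assoc; ++-identityʳ)
open import Data.Vec using (Vec; lookup) renaming ([] to []ᵥ; _∷_ to _∷ᵥ_; _++_ to _++ᵥ_)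
open import Data.Maybe using (just)
open import Data.Maybe.Properties using (just-injective)
open import Data.Product using (_×_; _,_)
open import Data.Product.Relation.Binary.Lex.Strict using (×-Lex)
open import Data.Sum using (inj₁; inj₂)
open import Data.Unit using (⊤; tt)
open import Data.Empty using (⊥-elim)
open import Relation.Binary.Definitions using (tri<; tri≈; tri>)
open import Relation.Binary.PropositionalEquality using (refl; sym; trans; cong; cong₂; subst; subst₂; module ≡-Reasoning)
open import Function.Bundles using (mk⇔; module Equivalence)

fromℕ : ℕ → ℚ
fromℕ n = + n ℚ./ 1

fromℕ≡mkℚ : ∀ n → fromℕ n ≡ mkℚ (+ n) 0 (coprime-sym (1-coprimeTo n))
fromℕ≡mkℚ n = ℚP.fromℚᵘ-toℚᵘ (mkℚ (+ n) 0 (coprime-sym (1-coprimeTo n)))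

fromℕ-+ : ∀ m n → fromℕ (m + n) ≡ fromℕ m ℚ.+ fromℕ n
fromℕ-+ m n = ℚP.toℚᵘ-injective (begin
  ℚ.toℚᵘ (fromℕ (m + n))                  ≈⟨ ℚP.toℚᵘ-fromℚᵘ (mkℚᵘ (+ (m + n)) 0) ⟩
  mkℚᵘ (+ (m + n)) 0                      ≡⟨ cong (λ z → mkℚᵘ z 0) (ℤP.pos-+ m n) ⟩
  mkℚᵘ (+ m ℤ.+ + n) 0                    ≈⟨ ℚᵘ.*≡* (cross-multiplied (+ m) (+ n)) ⟩
  mkℚᵘ (+ m) 0 ℚᵘ.+ mkℚᵘ (+ n) 0          ≈⟨ ℚᵘP.+-cong (fromℕ≃ m) (fromℕ≃ n) ⟩
  ℚ.toℚᵘ (fromℕ m) ℚᵘ.+ ℚ.toℚᵘ (fromℕ n)  ≈⟨ ℚᵘP.≃-sym (ℚP.toℚᵘ-homo-+ (fromℕ m) (fromℕ n)) ⟩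
  ℚ.toℚᵘ (fromℕ m ℚ.+ fromℕ n)            ∎)
  where
  open ℚᵘP.≃-Reasoning
  fromℕ≃ : ∀ k → mkℚᵘ (+ k) 0 ℚᵘ.≃ ℚ.toℚᵘ (fromℕ k)
  fromℕ≃ k = ℚᵘP.≃-sym (ℚP.toℚᵘ-fromℚᵘ (mkℚᵘ (+ k) 0))
  cross-multiplied : ∀ (x y : ℤ) → (x ℤ.+ y) ℤ.* (+ 1 ℤ.* + 1) ≡ (x ℤ.* + 1 ℤ.+ y ℤ.* + 1) ℤ.* + 1
  cross-multiplied = solve-∀

fromℕ-mono-≤ : ∀ {m n} → m ≤ n → fromℕ m ℚ.≤ fromℕ n
fromℕ-mono-≤ {m} {n} m≤n = subst₂ ℚ._≤_ (sym (fromℕ≡mkℚ m)) (sym (fromℕ≡mkℚ n))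
  (ℚ.*≤* (ℤP.*-monoʳ-≤-nonNeg (+ 1) (ℤ.+≤+ m≤n)))

drop-length-++ : ∀ {A : Set} (xs ys : List A) → drop (length xs) (xs ++ ys) ≡ ys
drop-length-++ []       ys = refl
drop-length-++ (x ∷ xs) ys = drop-length-++ xs ys

drop-+-of-≡++ : ∀ {A : Set} k (L xs ys : List A) → drop k L ≡ xs ++ ys → drop (k + length xs) L ≡ ys
drop-+-of-≡++ k L xs ys eq = begin
  drop (k + length xs) L       ≡⟨ sym (drop-drop k (length xs) L) ⟩
  drop (length xs) (drop k L)  ≡⟨ cong (drop (length xs)) eq ⟩
  drop (length xs) (xs ++ ys)  ≡⟨ drop-length-++ xs ys ⟩
  ys                           ∎
  where open ≡-Reasoning

drop-suc-of-≡∷ : ∀ {A : Set} k (L : List A) {x xs} → drop k L ≡ x ∷ xs → drop (suc k) L ≡ xs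
drop-suc-of-≡∷ zero    (y ∷ L) refl = refl
drop-suc-of-≡∷ (suc k) (y ∷ L) eq   = drop-suc-of-≡∷ k L eq

module _ (Σ : Signature) where

  halfPow-positive : ∀ k → ℚ.Positive (halfPow Σ k)
  halfPow-positive zero    = _
  halfPow-positive (suc k) = ℚP.pos*pos⇒pos ½ (halfPow Σ k) {{halfPow-positive k}}

  halfPow-suc-< : ∀ k → halfPow Σ (suc k) ℚ.< halfPow Σ k
  halfPow-suc-< k = subst (halfPow Σ (suc k) ℚ.<_) (ℚP.*-identityˡ (halfPow Σ k))
    (ℚP.*-monoˡ-<-pos (halfPow Σ k) {{halfPow-positive k}} ½<1)
    where
    ½<1 : ½ ℚ.< 1ℚ
    ½<1 = ℚ.*<* (ℤ.+<+ (s≤s (s≤s z≤n)))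

  halfPow≤1 : ∀ k → halfPow Σ k ℚ.≤ 1ℚ
  halfPow≤1 zero    = ℚP.≤-refl
  halfPow≤1 (suc k) = ℚP.≤-trans (ℚP.<⇒≤ (halfPow-suc-< k)) (halfPow≤1 k)

  halfPow-antimono-≤ : ∀ {m n} → m ≤ n → halfPow Σ n ℚ.≤ halfPow Σ m
  halfPow-antimono-≤ {n = n} z≤n = halfPow≤1 n
  halfPow-antimono-≤ (s≤s m≤n)   = ℚP.*-monoˡ-≤-nonNeg ½ (halfPow-antimono-≤ m≤n)

  halfPow-antimono-< : ∀ {m n} → m < n → halfPow Σ n ℚ.< halfPow Σ m
  halfPow-antimono-< {m} m<n = ℚP.≤-<-trans (halfPow-antimono-≤ m<n) (halfPow-suc-< m)

  cncValue : (p l a : ℕ) → ℚ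
  cncValue p l a = fromℕ (p + 1) ℚ.- halfPow Σ (a ∸ l)

  fromℕ≤cncValue : ∀ p l a → fromℕ p ℚ.≤ cncValue p l a
  fromℕ≤cncValue p l a = begin
    fromℕ p                           ≡⟨ sym (ℚP.+-identityʳ (fromℕ p)) ⟩
    fromℕ p ℚ.+ 0ℚ                    ≤⟨ ℚP.+-monoʳ-≤ (fromℕ p) 0≤1-h ⟩
    fromℕ p ℚ.+ (1ℚ ℚ.- h)            ≡⟨ sym (ℚP.+-assoc (fromℕ p) 1ℚ (ℚ.- h)) ⟩
    fromℕ p ℚ.+ 1ℚ ℚ.- h              ≡⟨ cong (ℚ._- h) (sym (fromℕ-+ p 1)) ⟩
    cncValue p l a                    ∎
    where
    open ℚP.≤-Reasoning
    h : ℚ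
    h = halfPow Σ (a ∸ l)
    0≤1-h : 0ℚ ℚ.≤ 1ℚ ℚ.- h
    0≤1-h = subst (ℚ._≤ 1ℚ ℚ.- h) (ℚP.+-inverseʳ h) (ℚP.+-monoˡ-≤ (ℚ.- h) (halfPow≤1 (a ∸ l)))

  cncValue<fromℕ : ∀ p l a → cncValue p l a ℚ.< fromℕ (p + 1)
  cncValue<fromℕ p l a = subst (cncValue p l a ℚ.<_) (ℚP.+-identityʳ (fromℕ (p + 1)))
    (ℚP.+-monoʳ-< (fromℕ (p + 1))
      (ℚP.neg-antimono-< (ℚP.positive⁻¹ (halfPow Σ (a ∸ l)) {{halfPow-positive (a ∸ l)}})))

  cncValue-<-parent : ∀ {p₁ p₂} l₁ a₁ l₂ a₂ → p₁ < p₂ → cncValue p₁ l₁ a₁ ℚ.< cncValue p₂ l₂ a₂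
  cncValue-<-parent {p₁} {p₂} l₁ a₁ l₂ a₂ p₁<p₂ = begin-strict
    cncValue p₁ l₁ a₁  <⟨ cncValue<fromℕ p₁ l₁ a₁ ⟩
    fromℕ (p₁ + 1)     ≤⟨ fromℕ-mono-≤ (subst (_≤ p₂) (ℕP.+-comm 1 p₁) p₁<p₂) ⟩
    fromℕ p₂           ≤⟨ fromℕ≤cncValue p₂ l₂ a₂ ⟩
    cncValue p₂ l₂ a₂  ∎
    where open ℚP.≤-Reasoning

  cncValue-antimono-≤ : ∀ p a {l₁ l₂} → l₁ ≤ l₂ → cncValue p l₂ a ℚ.≤ cncValue p l₁ a
  cncValue-antimono-≤ p a l₁≤l₂ = ℚP.+-monoʳ-≤ (fromℕ (p + 1))
    (ℚP.neg-antimono-≤ (halfPow-antimono-≤ (ℕP.∸-monoʳ-≤ a l₁≤l₂)))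

  cncValue-antimono-< : ∀ p a {l₁ l₂} → l₁ < l₂ → l₂ ≤ a → cncValue p l₂ a ℚ.< cncValue p l₁ a
  cncValue-antimono-< p a l₁<l₂ l₂≤a = ℚP.+-monoʳ-< (fromℕ (p + 1))
    (ℚP.neg-antimono-< (halfPow-antimono-< (ℕP.∸-monoʳ-< l₁<l₂ l₂≤a)))

  -- ×-Lex _≡_ _<_ _≥_ on (parent, lp) unfolds to the second component of Dominated.
  cncValue-≤⇔lex : ∀ {p₁ l₁ a₁ p₂ l₂ a₂} → l₂ ≤ a₂ → (p₁ ≡ p₂ → a₁ ≡ a₂) →
    cncValue p₁ l₁ a₁ ℚ.≤ cncValue p₂ l₂ a₂ ⇔ ×-Lex _≡_ _<_ _≥_ (p₁ , l₁) (p₂ , l₂)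
  cncValue-≤⇔lex {p₁} {l₁} {a₁} {p₂} {l₂} {a₂} l₂≤a₂ same-arity = mk⇔ to from
    where
    to : cncValue p₁ l₁ a₁ ℚ.≤ cncValue p₂ l₂ a₂ → ×-Lex _≡_ _<_ _≥_ (p₁ , l₁) (p₂ , l₂)
    to c≤c with ℕP.<-cmp p₁ p₂
    ... | tri< p₁<p₂ _ _ = inj₁ p₁<p₂
    ... | tri> _ _ p₂<p₁ =
      ⊥-elim (ℚP.<-irrefl refl (ℚP.<-≤-trans (cncValue-<-parent l₂ a₂ l₁ a₁ p₂<p₁) c≤c))
    ... | tri≈ _ refl _ with same-arity refl
    ...   | refl = inj₂ (refl , ℕP.≮⇒≥ λ l₁<l₂ →
      ℚP.<-irrefl refl (ℚP.<-≤-trans (cncValue-antimono-< p₁ a₁ l₁<l₂ l₂≤a₂) c≤c))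
    from : ×-Lex _≡_ _<_ _≥_ (p₁ , l₁) (p₂ , l₂) → cncValue p₁ l₁ a₁ ℚ.≤ cncValue p₂ l₂ a₂
    from (inj₁ p₁<p₂) = ℚP.<⇒≤ (cncValue-<-parent l₁ a₁ l₂ a₂ p₁<p₂)
    from (inj₂ (refl , l₂≤l₁)) with same-arity refl
    ... | refl = cncValue-antimono-≤ p₁ a₁ l₂≤l₁

  arities : List (Sym Σ) → List ℕ
  arities = map (arity Σ)

  -- Entry k is the arity of internal node k; nodes are numbered from 1, so entry 0 is padding.
  arityTable : List (Sym Σ) → List ℕ
  arityTable ds = 0 ∷ arities ds

  record ParentEdgeOf (L : List ℕ) (k : ℕ) (e : EdgeInfo Σ) : Set where
    field
      idx≡   : idx e ≡ k
      lp≤par : lp e ≤ par e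
      par-at : head (drop (pa e) L) ≡ just (par e)
  open ParentEdgeOf

  ParentEdgesFrom : List ℕ → ℕ → ∀ {n} → Vec (EdgeInfo Σ) n → Set
  ParentEdgesFrom L k []ᵥ       = ⊤
  ParentEdgesFrom L k (e ∷ᵥ es) = ParentEdgeOf L k e × ParentEdgesFrom L (suc k) es

  ParentEdgesFrom-++ : ∀ L k {m n} (es : Vec (EdgeInfo Σ) m) (fs : Vec (EdgeInfo Σ) n) →
    ParentEdgesFrom L k es → ParentEdgesFrom L (k + m) fs → ParentEdgesFrom L k (es ++ᵥ fs)
  ParentEdgesFrom-++ L k []ᵥ       fs _         wf-fs =
    subst (λ k′ → ParentEdgesFrom L k′ fs) (ℕP.+-identityʳ k) wf-fs
  ParentEdgesFrom-++ L k (e ∷ᵥ es) fs (wf-e , wf-es) wf-fs =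
    wf-e , ParentEdgesFrom-++ L (suc k) es fs wf-es
             (subst (λ k′ → ParentEdgesFrom L k′ fs) (ℕP.+-suc k _) wf-fs)

  ParentEdgesFrom-lookup : ∀ L k {n} (es : Vec (EdgeInfo Σ) n) → ParentEdgesFrom L k es →
    (i : Fin n) → ParentEdgeOf L (k + toℕ i) (lookup es i)
  ParentEdgesFrom-lookup L k (e ∷ᵥ es) (wf-e , _) Fin.zero =
    subst (λ k′ → ParentEdgeOf L k′ e) (sym (ℕP.+-identityʳ k)) wf-e
  ParentEdgesFrom-lookup L k (e ∷ᵥ es) (_ , wf-es) (Fin.suc i) =
    subst (λ k′ → ParentEdgeOf L k′ (lookup es i)) (sym (ℕP.+-suc k (toℕ i)))
      (ParentEdgesFrom-lookup L (suc k) es wf-es i)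

  mutual
    length-dc : ∀ t → length (dc Σ t) ≡ deg Σ t
    length-dc leaf        = refl
    length-dc (node s ts) = cong suc (length-dcs ts)

    length-dcs : ∀ {m} (ts : Vec (Term Σ) m) → length (dcs Σ ts) ≡ degs Σ ts
    length-dcs []ᵥ       = refl
    length-dcs (t ∷ᵥ ts) = trans (length-++ (dc Σ t)) (cong₂ _+_ (length-dc t) (length-dcs ts))

  mutual
    pe-wf : ∀ L t k p j a ys → drop k L ≡ arities (dc Σ t) ++ ys →
            head (drop p L) ≡ just a → j ≤ a → ParentEdgesFrom L k (pe Σ t k p j a)
    pe-wf L leaf        k p j a ys _    _    _   = tt
    pe-wf L (node s ts) k p j a ys at-k at-p j≤a =
      record { idx≡ = refl ; lp≤par = j≤a ; par-at = at-p } ,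
      pes-wf L ts (suc k) k 1 (arity Σ s) ys (drop-suc-of-≡∷ k L at-k) (cong head at-k) ℕP.≤-refl

    -- The m children ts sit at child positions j, …, j + m − 1 of a node of arity a.
    pes-wf : ∀ L {m} (ts : Vec (Term Σ) m) k p j a ys →
             drop k L ≡ arities (dcs Σ ts) ++ ys →
             head (drop p L) ≡ just a → j + m ≤ suc a → ParentEdgesFrom L k (pes Σ ts k p j a)
    pes-wf L []ᵥ               k p j a ys _    _    _       = tt
    pes-wf L {suc m} (t ∷ᵥ ts) k p j a ys at-k at-p j+m≤1+a =
      ParentEdgesFrom-++ L k (pe Σ t k p j a) (pes Σ ts (k + deg Σ t) p (suc j) a)
        (pe-wf L t k p j a (arities (dcs Σ ts) ++ ys) at-k′ at-p j≤a)
        (pes-wf L ts (k + deg Σ t) p (suc j) a ys at-k+deg at-p 1+j+m≤1+a)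
      where
      1+j+m≤1+a : suc j + m ≤ suc a
      1+j+m≤1+a = subst (_≤ suc a) (ℕP.+-suc j m) j+m≤1+a
      j≤a : j ≤ a
      j≤a = s≤s⁻¹ (ℕP.≤-trans (s≤s (ℕP.m≤m+n j m)) 1+j+m≤1+a)
      at-k′ : drop k L ≡ arities (dc Σ t) ++ (arities (dcs Σ ts) ++ ys)
      at-k′ = trans at-k (trans (cong (_++ ys) (map-++ (arity Σ) (dc Σ t) (dcs Σ ts)))
                                (++-assoc (arities (dc Σ t)) (arities (dcs Σ ts)) ys))
      at-k+deg : drop (k + deg Σ t) L ≡ arities (dcs Σ ts) ++ ys
      at-k+deg = subst (λ d → drop (k + d) L ≡ arities (dcs Σ ts) ++ ys)
        (trans (length-map (arity Σ) (dc Σ t)) (length-dc t))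
        (drop-+-of-≡++ k L (arities (dc Σ t)) (arities (dcs Σ ts) ++ ys) at-k′)

  parentEdges-wf : ∀ t → ParentEdgesFrom (arityTable (dc Σ t)) 1 (parentEdges Σ t)
  parentEdges-wf leaf        = tt
  parentEdges-wf (node s ts) =
    pe-wf (arityTable (dc Σ (node s ts))) (node s ts) 1 1 0 (arity Σ s) []
      (sym (++-identityʳ _)) refl z≤n

  parentEdge-fromℕ< : ∀ t {i} (i<deg : i < deg Σ t) →
    ParentEdgeOf (arityTable (dc Σ t)) (suc i) (parentEdge Σ t (fromℕ< i<deg))
  parentEdge-fromℕ< t i<deg =
    subst (λ k → ParentEdgeOf (arityTable (dc Σ t)) (suc k) (parentEdge Σ t (fromℕ< i<deg)))
      (toℕ-fromℕ< i<deg)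
      (ParentEdgesFrom-lookup (arityTable (dc Σ t)) 1 (parentEdges Σ t) (parentEdges-wf t) (fromℕ< i<deg))

  edgeCnc : EdgeInfo Σ → ℚ
  edgeCnc e = cncValue (pa e) (lp e) (par e)

  edgeCnc-≤⇔Dominated : ∀ {L k e₁ e₂} → ParentEdgeOf L k e₁ → ParentEdgeOf L k e₂ →
    edgeCnc e₁ ℚ.≤ edgeCnc e₂ ⇔ Dominated Σ e₁ e₂
  edgeCnc-≤⇔Dominated {e₁ = e₁} {e₂} wf₁ wf₂ =
    mk⇔ (λ c≤c → same-idx , Equivalence.to lex c≤c)
        (λ (_ , lex-≤) → Equivalence.from lex lex-≤)
    where
    same-idx : idx e₁ ≡ idx e₂
    same-idx = trans (idx≡ wf₁) (sym (idx≡ wf₂))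
    same-arity : pa e₁ ≡ pa e₂ → par e₁ ≡ par e₂
    same-arity refl = just-injective (trans (sym (par-at wf₁)) (par-at wf₂))
    lex : edgeCnc e₁ ℚ.≤ edgeCnc e₂ ⇔ ×-Lex _≡_ _<_ _≥_ (pa e₁ , lp e₁) (pa e₂ , lp e₂)
    lex = cncValue-≤⇔lex (lp≤par wf₂) same-arity

lemma2p2p4 : (Σ : Signature) (t₁ t₂ : Term Σ) (n : ℕ)
    → deg Σ t₁ ≡ n → deg Σ t₂ ≡ n → dc Σ t₁ ≡ dc Σ t₂
    → (_⪯_ Σ t₁ t₂ ⇔
        (∀ (i : ℕ) (p₁ : i < deg Σ t₁) (p₂ : i < deg Σ t₂) →
           Dominated Σ (parentEdge Σ t₁ (fromℕ< p₁)) (parentEdge Σ t₂ (fromℕ< p₂))))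
lemma2p2p4 Σ t₁ t₂ n _ _ dc≡ = mk⇔
  (λ (_ , cnc≤) i p₁ p₂ → Equivalence.to (compare p₁ p₂) (cnc≤ i p₁ p₂))
  (λ dominated → dc≡ , λ i p₁ p₂ → Equivalence.from (compare p₁ p₂) (dominated i p₁ p₂))
  where
  compare : ∀ {i} (p₁ : i < deg Σ t₁) (p₂ : i < deg Σ t₂) →
    cnc Σ t₁ (fromℕ< p₁) ℚ.≤ cnc Σ t₂ (fromℕ< p₂)
      ⇔ Dominated Σ (parentEdge Σ t₁ (fromℕ< p₁)) (parentEdge Σ t₂ (fromℕ< p₂))
  compare {i} p₁ p₂ = edgeCnc-≤⇔Dominated Σ
    (subst (λ L → ParentEdgeOf Σ L (suc i) (parentEdge Σ t₁ (fromℕ< p₁)))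
      (cong (arityTable Σ) dc≡)
      (parentEdge-fromℕ< Σ t₁ p₁))
    (parentEdge-fromℕ< Σ t₂ p₂)
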